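{- Let $G$ be a graph with $n$ vertices, let $s\ge 1$ be an integer, and let $\mathcal{P}$ be a clique partition of $G$ consisting of cliques of size at most $s$. Then the weight of $\mathcal{P}$ is at least $(s+1)^{\lfloor n/s\rfloor}\cdot\big((n \bmod s)+1\big)$.
   Context: Graphs are finite, simple and undirected. A clique partition of $G$ is a partition of $V(G)$ into sets each of which is a clique in $G$. The weight of a clique partition $\{P_1,\dots,P_k\}$ is $\prod_{i=1}^{k}(|P_i|+1)$. -}

module Defs where

open import Data.Nat using (ℕ; suc; _*_; _≤_)
open import Data.Fin using (Fin)
open import Data.List using (List; []; _∷_; length; concat; map; allFin)
open import Data.Nat.ListAction using (product)
open import Relation.Binary.PropositionalEquality using (_≡_)
open import Data.Empty using (⊥)
open import Data.Unit using (⊤)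
open import Data.List.Relation.Unary.All using (All)
open import Data.List.Membership.Propositional using (_∈_)
open import Data.List.Relation.Binary.Permutation.Propositional using (_↭_)
open import Relation.Nullary using (¬_)
open import Data.Product using (_×_)

record Graph (n : ℕ) : Set₁ where
  field
    Adj   : Fin n → Fin n → Set
    sym   : ∀ {u v} → Adj u v → Adj v u
    irrefl : ∀ {v} → ¬ Adj v v

IsClique : ∀ {n} → Graph n → List (Fin n) → Set
IsClique G P = ∀ {u v} → u ∈ P → v ∈ P → ¬ (u ≡ v) → Graph.Adj G u v

NonEmpty : ∀ {A : Set} → List A → Set
NonEmpty [] = ⊥
NonEmpty (_ ∷ _) = ⊤

record CliquePartition {n : ℕ} (G : Graph n) : Set₁ where
  field
    blocks    : List (List (Fin n))
    nonempty  : All NonEmpty blocks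
    cliques   : All (IsClique G) blocks
    partition : concat blocks ↭ allFin n

weight : ∀ {n} {G : Graph n} → CliquePartition G → ℕ
weight 𝒫 = product (map (λ P → suc (length P)) (CliquePartition.blocks 𝒫))

BlocksAtMost : ∀ {n} {G : Graph n} → ℕ → CliquePartition G → Set
BlocksAtMost s 𝒫 = All (λ P → length P ≤ s) (CliquePartition.blocks 𝒫)

-- Call (q , r) a splitting of N when q s + r = N; r need not be below s.
-- By induction over the blocks, every splitting of the total block size
-- satisfies (s+1)^q (r+1) ≤ ∏ (|P|+1). A block of size a ≤ s is absorbed
-- either by the remainder (r = a + r', using (a+1)(r'+1) ≥ a+r'+1) or, when
-- a > r, by one factor s+1 whose surplus s − a moves into the remainder;
-- the exchange inequality (a+e+1)(r+1) ≤ (a+1)(r+e+1) for r ≤ a makes this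
-- move harmless. The division splitting (n / s , n % s) gives the theorem.
module Submission where

open import Defs
open import Data.Nat using (ℕ; zero; suc; _+_; _*_; _^_; _≤_; _<_; _/_; _%_; NonZero)
open import Data.Nat.Properties
open import Data.Nat.DivMod using (m≡m%n+[m/n]*n)
open import Data.Nat.ListAction using (product)
open import Data.Nat.Solver using (module +-*-Solver)
open import Data.List using (List; []; _∷_; length; concat; map; allFin)
open import Data.List.Properties using (length-++; length-tabulate)
open import Data.List.Relation.Unary.All using (All; []; _∷_)
open import Data.List.Relation.Binary.Permutation.Propositional.Properties using (↭-length)
open import Data.Product using (_,_)
open import Data.Sum using (inj₁; inj₂)
open import Relation.Binary.PropositionalEquality
open import Relation.Nullary using (contradiction)

open import Algebra.Properties.CommutativeSemigroup +-commutativeSemigroup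
  using () renaming (x∙yz≈y∙xz to x+[y+z]≡y+[x+z])
open import Algebra.Properties.CommutativeSemigroup *-commutativeSemigroup
  using () renaming (x∙yz≈y∙xz to x*[y*z]≡y*[x*z]; xy∙z≈y∙xz to [x*y]*z≡y*[x*z])
open +-*-Solver

≤-from-+ : ∀ {m n} k → n ≡ m + k → m ≤ n
≤-from-+ {m} k eq = subst (m ≤_) (sym eq) (m≤m+n m k)

suc-+-≤-suc-*-suc : ∀ a b → suc (a + b) ≤ suc a * suc b
suc-+-≤-suc-*-suc a b = ≤-from-+ (a * b) (solve 2 (λ a b →
  (con 1 :+ a) :* (con 1 :+ b) := (con 1 :+ (a :+ b)) :+ a :* b) refl a b)

exchange-≤ : ∀ {r a} e → r ≤ a → suc (a + e) * suc r ≤ suc a * suc (r + e)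
exchange-≤ {r} e r≤a with m≤n⇒∃[o]m+o≡n r≤a
... | d , refl = ≤-from-+ (e * d) (solve 3 (λ r d e →
  (con 1 :+ (r :+ d)) :* (con 1 :+ (r :+ e))
    := (con 1 :+ ((r :+ d) :+ e)) :* (con 1 :+ r) :+ e :* d) refl r d e)

PowerBound : ℕ → ℕ → ℕ → Set
PowerBound s N p = ∀ q r → q * s + r ≡ N → suc s ^ q * suc r ≤ p

powerBound-0 : ∀ s → PowerBound s 0 1
powerBound-0 s zero .0 refl = ≤-refl
powerBound-0 s (suc q) r eq
  with m+n≡0⇒m≡0 s (trans (sym (+-assoc s (q * s) r)) eq) | m+n≡0⇒n≡0 (suc q * s) eq
... | refl | refl = ≤-reflexive (trans (*-identityʳ _) (^-zeroˡ (suc q)))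

powerBound-∷-remainder : ∀ {s a m p} q r → PowerBound s m p →
  q * s + (a + r) ≡ a + m → suc s ^ q * suc (a + r) ≤ suc a * p
powerBound-∷-remainder {s} {a} {m} {p} q r bound eq = begin
  suc s ^ q * suc (a + r)      ≤⟨ *-monoʳ-≤ (suc s ^ q) (suc-+-≤-suc-*-suc a r) ⟩
  suc s ^ q * (suc a * suc r)  ≡⟨ x*[y*z]≡y*[x*z] (suc s ^ q) (suc a) (suc r) ⟩
  suc a * (suc s ^ q * suc r)  ≤⟨ *-monoʳ-≤ (suc a) (bound q r split) ⟩
  suc a * p                    ∎
  where
  open ≤-Reasoning
  split : q * s + r ≡ m
  split = +-cancelˡ-≡ a _ _ (trans (x+[y+z]≡y+[x+z] a (q * s) r) eq)

powerBound-∷-power : ∀ {a e m p} q r → r < a → PowerBound (a + e) m p →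
  suc q * (a + e) + r ≡ a + m → suc (a + e) ^ suc q * suc r ≤ suc a * p
powerBound-∷-power {a} {e} {m} {p} q r r<a bound eq = begin
  (suc s * suc s ^ q) * suc r      ≡⟨ [x*y]*z≡y*[x*z] (suc s) (suc s ^ q) (suc r) ⟩
  suc s ^ q * (suc s * suc r)      ≤⟨ *-monoʳ-≤ (suc s ^ q) (exchange-≤ e (<⇒≤ r<a)) ⟩
  suc s ^ q * (suc a * suc (r + e)) ≡⟨ x*[y*z]≡y*[x*z] (suc s ^ q) (suc a) (suc (r + e)) ⟩
  suc a * (suc s ^ q * suc (r + e)) ≤⟨ *-monoʳ-≤ (suc a) (bound q (r + e) split) ⟩
  suc a * p                        ∎
  where
  open ≤-Reasoning
  s : ℕ
  s = a + e
  split : q * s + (r + e) ≡ m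
  split = +-cancelˡ-≡ a _ _ (trans (solve 4 (λ a e Q r →
    a :+ (Q :+ (r :+ e)) := ((a :+ e) :+ Q) :+ r) refl a e (q * s) r) eq)

powerBound-∷ : ∀ {s a m p} → a ≤ s → PowerBound s m p → PowerBound s (a + m) (suc a * p)
powerBound-∷ {a = a} a≤s bound q r eq with m≤n⇒∃[o]m+o≡n a≤s | ≤-<-connex a r
... | e , refl | inj₁ a≤r with m≤n⇒∃[o]m+o≡n a≤r
...   | r' , refl = powerBound-∷-remainder q r' bound eq
powerBound-∷ {a = a} {m} a≤s bound zero r eq | e , refl | inj₂ r<a =
  contradiction (≤-from-+ m eq) (<⇒≱ r<a)
powerBound-∷ a≤s bound (suc q) r eq | e , refl | inj₂ r<a =
  powerBound-∷-power q r r<a bound eq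

powerBound-blocks : ∀ {A : Set} {s} (B : List (List A)) → All (λ P → length P ≤ s) B →
  PowerBound s (length (concat B)) (product (map (λ P → suc (length P)) B))
powerBound-blocks [] [] = powerBound-0 _
powerBound-blocks (P ∷ B) (P≤s ∷ B≤s) rewrite length-++ P {concat B} =
  powerBound-∷ P≤s (powerBound-blocks B B≤s)

lemma7 : ∀ (n s : ℕ) .{{_ : NonZero s}} (G : Graph n) (𝒫 : CliquePartition G) →
    BlocksAtMost s 𝒫 →
    (suc s) ^ (n / s) * suc (n % s) ≤ weight 𝒫
lemma7 n s G 𝒫 blocks≤s =
  powerBound-blocks blocks blocks≤s (n / s) (n % s) divisionSplitting
  where
  open CliquePartition 𝒫
  open ≡-Reasoning
  divisionSplitting : n / s * s + n % s ≡ length (concat blocks)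
  divisionSplitting = begin
    n / s * s + n % s        ≡⟨ +-comm (n / s * s) (n % s) ⟩
    n % s + n / s * s        ≡⟨ m≡m%n+[m/n]*n n s ⟨
    n                        ≡⟨ length-tabulate (λ v → v) ⟨
    length (allFin n)        ≡⟨ ↭-length partition ⟨
    length (concat blocks)   ∎
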